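{- There is a universal constant $C>0$ such that for any $n\ge1$ there exists a lattice $\mathcal{L}\subset\mathbb{Q}^n$ with \[ \mathrm{dist}(\mathcal{L},\mathbb{Z}^n)\ge C\sqrt{n}\cdot M(\mathcal{L},\mathbb{Z}^n)\cdot M(\mathbb{Z}^n,\mathcal{L}). \]
   Context: For full-rank lattices, $\lambda_i(\mathcal{L})$ is the $i$-th successive minimum (least $r$ such that $\mathcal{L}$ contains $i$ linearly independent vectors of Euclidean norm $\le r$), $M(\mathcal{L}_1,\mathcal{L}_2)=\max_{i\in[n]}\lambda_i(\mathcal{L}_2)/\lambda_i(\mathcal{L}_1)$, and $\mathrm{dist}(\mathcal{L}_1,\mathcal{L}_2)=\min\{\|T\|\,\|T^{ -1}\|: T\text{ linear},\ T(\mathcal{L}_1)=\mathcal{L}_2\}$ with $\|\cdot\|$ the Euclidean operator norm. (The paper writes the factor as $\Omega(\sqrt n)$.) -}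

module Defs where

open import Data.Nat as ℕ using (ℕ; zero; suc)
open import Data.Integer as ℤ using (ℤ; +_)
open import Data.Fin using (Fin; zero; suc; toℕ)
open import Data.Rational using (ℚ; 0ℚ; 1ℚ; _+_; _*_; _≤_; _<_; _/_)
open import Data.Product using (Σ; ∃; _×_; _,_)
open import Relation.Binary.PropositionalEquality using (_≡_)

Vecℚ : ℕ → Set
Vecℚ n = Fin n → ℚ

Mat : ℕ → Set
Mat n = Fin n → Fin n → ℚ

sumF : ∀ {n} → (Fin n → ℚ) → ℚ
sumF {zero}  f = 0ℚ
sumF {suc n} f = f zero + sumF (λ i → f (suc i))

ℤtoℚ : ℤ → ℚ
ℤtoℚ z = z / 1

ℕtoℚ : ℕ → ℚ
ℕtoℚ k = (+ k) / 1

_·_ : ∀ {n} → Mat n → Vecℚ n → Vecℚ n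
(A · x) i = sumF (λ j → A i j * x j)

normSq : ∀ {n} → Vecℚ n → ℚ
normSq x = sumF (λ i → x i * x i)

idMat : ∀ {n} → Mat n
idMat zero    zero    = 1ℚ
idMat zero    (suc j) = 0ℚ
idMat (suc i) zero    = 0ℚ
idMat (suc i) (suc j) = idMat i j

_⊙_ : ∀ {n} → Mat n → Mat n → Mat n
(A ⊙ B) i k = sumF (λ j → A i j * B j k)

-- A full-rank lattice in ℚ^n is given by a basis matrix B (columns = basis
-- vectors) whose columns are linearly independent over ℚ.
Nonsingular : ∀ {n} → Mat n → Set
Nonsingular {n} B = (x : Vecℚ n) → (∀ i → (B · x) i ≡ 0ℚ) → ∀ j → x j ≡ 0ℚ

InLattice : ∀ {n} → Mat n → Vecℚ n → Set
InLattice {n} B v = Σ (Fin n → ℤ) λ z → ∀ i → v i ≡ (B · (λ j → ℤtoℚ (z j))) i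

ℤⁿ : ∀ {n} → Mat n
ℤⁿ = idMat

LinIndep : ∀ {n k} → (Fin k → Vecℚ n) → Set
LinIndep {n} {k} vs =
  (c : Fin k → ℚ) → (∀ i → sumF (λ j → c j * vs j i) ≡ 0ℚ) → ∀ j → c j ≡ 0ℚ

HasIndep : ∀ {n} → Mat n → ℕ → ℚ → Set
HasIndep {n} B k r =
  Σ (Fin k → Vecℚ n) λ vs →
    (∀ j → InLattice B (vs j)) × LinIndep vs × (∀ j → normSq (vs j) ≤ r)

-- r is the SQUARE of the k-th successive minimum λ_k(L(B)):
-- the least r such that L(B) has k independent vectors of squared norm ≤ r.
IsSuccMinSq : ∀ {n} → Mat n → ℕ → ℚ → Set
IsSuccMinSq B k r = HasIndep B k r × (∀ r' → HasIndep B k r' → r ≤ r')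

-- m is the SQUARE of M(L(B₁), L(B₂)) = max_i λ_i(L(B₂)) / λ_i(L(B₁)).
IsMSq : ∀ {n} → Mat n → Mat n → ℚ → Set
IsMSq {n} B₁ B₂ m =
  Σ (Fin n → ℚ) λ l₁ → Σ (Fin n → ℚ) λ l₂ →
    (∀ i → IsSuccMinSq B₁ (suc (toℕ i)) (l₁ i)) ×
    (∀ i → IsSuccMinSq B₂ (suc (toℕ i)) (l₂ i)) ×
    (∀ i → l₂ i ≤ m * l₁ i) ×
    (∃ λ i → l₂ i ≡ m * l₁ i)

MapsOnto : ∀ {n} → Mat n → Mat n → Mat n → Mat n → Set
MapsOnto {n} T Tinv B₁ B₂ =
  (∀ i j → (T ⊙ Tinv) i j ≡ idMat i j) ×
  (∀ i j → (Tinv ⊙ T) i j ≡ idMat i j) ×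
  (∀ v → InLattice B₁ v → InLattice B₂ (T · v)) ×
  (∀ w → InLattice B₂ w → Σ (Vecℚ n) λ v → InLattice B₁ v × (∀ i → (T · v) i ≡ w i))

-- ‖T‖²‖T⁻¹‖² ≥ X, expressed as: for every rational q < X there are x, y with
-- |Tx|²|T⁻¹y|² > q |x|²|y|²  (sup of the ratio over rational x,y = over real x,y).
CondSqGe : ∀ {n} → Mat n → Mat n → ℚ → Set
CondSqGe {n} T Tinv X =
  ∀ q → q < X → Σ (Vecℚ n) λ x → Σ (Vecℚ n) λ y →
    q * normSq x * normSq y < normSq (T · x) * normSq (Tinv · y)

-- Take L = Dₙ* = ℤⁿ ∪ (ℤⁿ + ½𝟙) when n ≥ 4 and L = ℤⁿ when n < 4.  Both lattices
-- contain e₁, …, eₙ and no nonzero vector shorter than 1, so all their successive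
-- minima equal 1 and M(L, ℤⁿ) = M(ℤⁿ, L) = 1.  If T maps L onto ℤⁿ then each T eⱼ
-- is a nonzero integer vector, so ‖T‖ ≥ 1 and ‖T‖‖T⁻¹‖ ≥ |T⁻¹ eⱼ| for every j.
-- For L = Dₙ* some column T⁻¹ eⱼ lies in ℤⁿ + ½𝟙, since otherwise T⁻¹ would be an
-- integer matrix and L ⊆ T⁻¹ ℤⁿ ⊆ ℤⁿ; such a vector has squared length ≥ n/4.
-- For n < 4 the bound |T⁻¹ eⱼ|² ≥ 1 ≥ n/4 suffices.  Hence c = ¼ works for the squares.
module Submission where

open import Defs
open import Data.Nat using (ℕ; zero; suc)
import Data.Nat as ℕ
import Data.Nat.Properties as ℕP
import Data.Nat.Coprimality as Coprime
open import Data.Integer as ℤ using (ℤ; +_; +0; +[1+_]; -[1+_])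
import Data.Integer.Properties as ℤP
open import Data.Integer.DivMod using (_%ℕ_; _/ℕ_; n%ℕd<d; a≡a%ℕn+[a/ℕn]*n)
open import Data.Fin using (Fin; zero; suc; toℕ; inject≤)
import Data.Fin.Properties as FinP
open import Data.Rational as ℚ using (ℚ; mkℚ; 0ℚ; 1ℚ; _+_; _*_; _≤_; _<_; _/_; ↧ₙ_)
import Data.Rational.Properties as ℚP
open import Data.Rational.Solver using (module +-*-Solver)
import Data.Rational.Unnormalised as ℚᵘ
import Data.Rational.Unnormalised.Properties as ℚᵘP
open import Algebra.Bundles using (CommutativeRing)
open import Algebra.Properties.Semiring.Sum (CommutativeRing.semiring ℚP.+-*-commutativeRing)
  using (sum; sum-cong-≗; ∑-comm; *-distribˡ-sum; *-distribʳ-sum; sum-replicate-zero)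
open import Data.Product using (Σ; ∃; _,_; _×_; proj₁; proj₂)
open import Data.Sum using (_⊎_; inj₁; inj₂; [_,_]′)
open import Function using (_∘_)
open import Relation.Binary.PropositionalEquality
open import Relation.Nullary using (¬_; yes; no)
open import Relation.Nullary.Negation using (contradiction)

ℤtoℚ≡mkℚ : ∀ z → ℤtoℚ z ≡ mkℚ z 0 (Coprime.sym (Coprime.1-coprimeTo _))
ℤtoℚ≡mkℚ (+ n)    = ℚP.normalize-coprime {n} {0} (Coprime.sym (Coprime.1-coprimeTo _))
ℤtoℚ≡mkℚ -[1+ n ] =
  cong ℚ.-_ (ℚP.normalize-coprime {suc n} {0} (Coprime.sym (Coprime.1-coprimeTo _)))

toℚᵘ-ℤtoℚ : ∀ z → ℚ.toℚᵘ (ℤtoℚ z) ≡ ℚᵘ.mkℚᵘ z 0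
toℚᵘ-ℤtoℚ z rewrite ℤtoℚ≡mkℚ z = refl

ℤtoℚ-+ : ∀ a b → ℤtoℚ (a ℤ.+ b) ≡ ℤtoℚ a + ℤtoℚ b
ℤtoℚ-+ a b = ℚP.toℚᵘ-injective (begin
  ℚ.toℚᵘ (ℤtoℚ (a ℤ.+ b))
    ≡⟨ toℚᵘ-ℤtoℚ (a ℤ.+ b) ⟩
  ℚᵘ.mkℚᵘ (a ℤ.+ b) 0
    ≈⟨ ℚᵘ.*≡* (cong (ℤ._* + 1) (cong₂ ℤ._+_ (sym (ℤP.*-identityʳ a)) (sym (ℤP.*-identityʳ b)))) ⟩
  ℚᵘ.mkℚᵘ a 0 ℚᵘ.+ ℚᵘ.mkℚᵘ b 0
    ≡⟨ sym (cong₂ ℚᵘ._+_ (toℚᵘ-ℤtoℚ a) (toℚᵘ-ℤtoℚ b)) ⟩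
  ℚ.toℚᵘ (ℤtoℚ a) ℚᵘ.+ ℚ.toℚᵘ (ℤtoℚ b)
    ≈⟨ ℚᵘP.≃-sym (ℚP.toℚᵘ-homo-+ (ℤtoℚ a) (ℤtoℚ b)) ⟩
  ℚ.toℚᵘ (ℤtoℚ a + ℤtoℚ b)
    ∎)
  where open ℚᵘP.≃-Reasoning

ℤtoℚ-* : ∀ a b → ℤtoℚ (a ℤ.* b) ≡ ℤtoℚ a * ℤtoℚ b
ℤtoℚ-* a b = ℚP.toℚᵘ-injective (begin
  ℚ.toℚᵘ (ℤtoℚ (a ℤ.* b))
    ≡⟨ toℚᵘ-ℤtoℚ (a ℤ.* b) ⟩
  ℚᵘ.mkℚᵘ a 0 ℚᵘ.* ℚᵘ.mkℚᵘ b 0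
    ≡⟨ sym (cong₂ ℚᵘ._*_ (toℚᵘ-ℤtoℚ a) (toℚᵘ-ℤtoℚ b)) ⟩
  ℚ.toℚᵘ (ℤtoℚ a) ℚᵘ.* ℚ.toℚᵘ (ℤtoℚ b)
    ≈⟨ ℚᵘP.≃-sym (ℚP.toℚᵘ-homo-* (ℤtoℚ a) (ℤtoℚ b)) ⟩
  ℚ.toℚᵘ (ℤtoℚ a * ℤtoℚ b)
    ∎)
  where open ℚᵘP.≃-Reasoning

ℤtoℚ-mono-≤ : ∀ {a b} → a ℤ.≤ b → ℤtoℚ a ≤ ℤtoℚ b
ℤtoℚ-mono-≤ {a} {b} a≤b = ℚP.toℚᵘ-cancel-≤
  (subst₂ ℚᵘ._≤_ (sym (toℚᵘ-ℤtoℚ a)) (sym (toℚᵘ-ℤtoℚ b))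
    (ℚᵘ.*≤* (subst₂ ℤ._≤_ (sym (ℤP.*-identityʳ a)) (sym (ℤP.*-identityʳ b)) a≤b)))

ℕtoℚ-mono-≤ : ∀ {m n} → m ℕ.≤ n → ℕtoℚ m ≤ ℕtoℚ n
ℕtoℚ-mono-≤ m≤n = ℤtoℚ-mono-≤ (ℤ.+≤+ m≤n)

ℕtoℚ-suc : ∀ n → ℕtoℚ (suc n) ≡ 1ℚ + ℕtoℚ n
ℕtoℚ-suc n = ℤtoℚ-+ (+ 1) (+ n)

1≤ℤtoℚ² : ∀ {k} → k ≢ +0 → 1ℚ ≤ ℤtoℚ k * ℤtoℚ k
1≤ℤtoℚ² {k} k≢0 = subst (1ℚ ≤_) (ℤtoℚ-* k k) (ℤtoℚ-mono-≤ (1≤k² k k≢0))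
  where
  1≤k² : ∀ k → k ≢ +0 → + 1 ℤ.≤ k ℤ.* k
  1≤k² +0       k≢0 = contradiction refl k≢0
  1≤k² +[1+ n ] _   = ℤ.+≤+ (ℕ.s≤s ℕ.z≤n)
  1≤k² -[1+ n ] _   = ℤ.+≤+ (ℕ.s≤s ℕ.z≤n)

0≤p*p : ∀ p → 0ℚ ≤ p * p
0≤p*p p with ℚP.≤-total 0ℚ p
... | inj₁ 0≤p = ℚP.nonNegative⁻¹ (p * p)
  {{ℚP.nonNeg*nonNeg⇒nonNeg p {{ℚ.nonNegative 0≤p}} p {{ℚ.nonNegative 0≤p}}}}
... | inj₂ p≤0 = ℚP.nonNegative⁻¹ (p * p)
  {{ℚP.nonPos*nonPos⇒nonPos p {{ℚ.nonPositive p≤0}} p {{ℚ.nonPositive p≤0}}}}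

½ : ℚ
½ = + 1 / 2

¼ : ℚ
¼ = + 1 / 4

½*ℤtoℚ-+-*2 : ∀ r q → ½ * ℤtoℚ (r ℤ.+ q ℤ.* + 2) ≡ ½ * ℤtoℚ r + ℤtoℚ q
½*ℤtoℚ-+-*2 r q = begin
  ½ * ℤtoℚ (r ℤ.+ q ℤ.* + 2)            ≡⟨ cong (½ *_) (trans (ℤtoℚ-+ r (q ℤ.* + 2))
                                                             (cong (λ t → ℤtoℚ r + t) (ℤtoℚ-* q (+ 2)))) ⟩
  ½ * (ℤtoℚ r + ℤtoℚ q * ℤtoℚ (+ 2))    ≡⟨ solve 2 (λ a b → con ½ :* (a :+ b :* con (ℤtoℚ (+ 2)))
                                                        := con ½ :* a :+ b)
                                              refl (ℤtoℚ r) (ℤtoℚ q) ⟩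
  ½ * ℤtoℚ r + ℤtoℚ q                   ∎
  where open ≡-Reasoning; open +-*-Solver

-- ½ + k = ½ (1 + 2k), and the odd integer 1 + 2k has square at least 1.
¼≤[½+ℤtoℚ]² : ∀ k → ¼ ≤ (½ + ℤtoℚ k) * (½ + ℤtoℚ k)
¼≤[½+ℤtoℚ]² k = begin
  ¼                              ≡⟨ sym (ℚP.*-identityʳ ¼) ⟩
  ¼ * 1ℚ                         ≤⟨ ℚP.*-monoˡ-≤-nonNeg ¼ (1≤ℤtoℚ² (odd≢0 k)) ⟩
  ¼ * (ℤtoℚ o * ℤtoℚ o)          ≡⟨ solve 1 (λ a → con ¼ :* (a :* a) := (con ½ :* a) :* (con ½ :* a))
                                          refl (ℤtoℚ o) ⟩
  (½ * ℤtoℚ o) * (½ * ℤtoℚ o)    ≡⟨ cong (λ t → t * t) (½*ℤtoℚ-+-*2 (+ 1) k) ⟩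
  (½ + ℤtoℚ k) * (½ + ℤtoℚ k)    ∎
  where
  open ℚP.≤-Reasoning
  open +-*-Solver
  o : ℤ
  o = + 1 ℤ.+ k ℤ.* + 2
  odd≢0 : ∀ k → + 1 ℤ.+ k ℤ.* + 2 ≢ +0
  odd≢0 +0       ()
  odd≢0 +[1+ n ] ()
  odd≢0 -[1+ n ] ()

sumF≡sum : ∀ {n} (f : Fin n → ℚ) → sumF f ≡ sum f
sumF≡sum {zero}  f = refl
sumF≡sum {suc n} f = cong (λ t → f zero + t) (sumF≡sum (f ∘ suc))

sumF-cong : ∀ {n} {f g : Fin n → ℚ} → (∀ i → f i ≡ g i) → sumF f ≡ sumF g
sumF-cong {f = f} {g} f≗g = trans (sumF≡sum f) (trans (sum-cong-≗ f≗g) (sym (sumF≡sum g)))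

sumF-0 : ∀ n → sumF {n} (λ _ → 0ℚ) ≡ 0ℚ
sumF-0 n = trans (sumF≡sum {n} (λ _ → 0ℚ)) (sum-replicate-zero n)

sumF-*ˡ : ∀ {n} a (f : Fin n → ℚ) → a * sumF f ≡ sumF (λ i → a * f i)
sumF-*ˡ a f = begin
  a * sumF f                ≡⟨ cong (a *_) (sumF≡sum f) ⟩
  a * sum f                 ≡⟨ *-distribˡ-sum a f ⟩
  sum (λ i → a * f i)       ≡⟨ sym (sumF≡sum (λ i → a * f i)) ⟩
  sumF (λ i → a * f i)      ∎
  where open ≡-Reasoning

sumF-*ʳ : ∀ {n} a (f : Fin n → ℚ) → sumF f * a ≡ sumF (λ i → f i * a)
sumF-*ʳ a f = begin
  sumF f * a                ≡⟨ cong (_* a) (sumF≡sum f) ⟩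
  sum f * a                 ≡⟨ *-distribʳ-sum a f ⟩
  sum (λ i → f i * a)       ≡⟨ sym (sumF≡sum (λ i → f i * a)) ⟩
  sumF (λ i → f i * a)      ∎
  where open ≡-Reasoning

sumF-comm : ∀ {m n} (f : Fin m → Fin n → ℚ) →
            sumF (λ i → sumF (f i)) ≡ sumF (λ j → sumF (λ i → f i j))
sumF-comm f = begin
  sumF (λ i → sumF (f i))          ≡⟨ sumF²≡sum² f ⟩
  sum (λ i → sum (f i))            ≡⟨ ∑-comm f ⟩
  sum (λ j → sum (λ i → f i j))    ≡⟨ sym (sumF²≡sum² (λ j i → f i j)) ⟩
  sumF (λ j → sumF (λ i → f i j))  ∎
  where
  open ≡-Reasoning
  sumF²≡sum² : ∀ {m n} (g : Fin m → Fin n → ℚ) → sumF (λ i → sumF (g i)) ≡ sum (λ i → sum (g i))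
  sumF²≡sum² g = trans (sumF≡sum (λ i → sumF (g i))) (sum-cong-≗ (sumF≡sum ∘ g))

sumF-nonNeg : ∀ {n} {f : Fin n → ℚ} → (∀ i → 0ℚ ≤ f i) → 0ℚ ≤ sumF f
sumF-nonNeg {zero}  _     = ℚP.≤-refl
sumF-nonNeg {suc n} 0≤f = ℚP.+-mono-≤ (0≤f zero) (sumF-nonNeg (0≤f ∘ suc))

≤-sumF : ∀ {n} {f : Fin n → ℚ} → (∀ i → 0ℚ ≤ f i) → ∀ j → f j ≤ sumF f
≤-sumF {suc n} {f} 0≤f zero = subst (_≤ sumF f) (ℚP.+-identityʳ (f zero))
  (ℚP.+-monoʳ-≤ (f zero) (sumF-nonNeg (0≤f ∘ suc)))
≤-sumF {suc n} {f} 0≤f (suc j) = subst (_≤ sumF f) (ℚP.+-identityˡ (f (suc j)))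
  (ℚP.+-mono-≤ (0≤f zero) (≤-sumF (0≤f ∘ suc) j))

ℕtoℚ*≤sumF : ∀ {n a} {f : Fin n → ℚ} → (∀ i → a ≤ f i) → ℕtoℚ n * a ≤ sumF f
ℕtoℚ*≤sumF {zero}  {a} _   = ℚP.≤-reflexive (ℚP.*-zeroˡ a)
ℕtoℚ*≤sumF {suc n} {a} a≤f =
  subst (_≤ _) (sym n+1*a≡a+n*a) (ℚP.+-mono-≤ (a≤f zero) (ℕtoℚ*≤sumF (a≤f ∘ suc)))
  where
  n+1*a≡a+n*a : ℕtoℚ (suc n) * a ≡ a + ℕtoℚ n * a
  n+1*a≡a+n*a = trans (cong (_* a) (ℕtoℚ-suc n))
    (trans (ℚP.*-distribʳ-+ a 1ℚ (ℕtoℚ n)) (cong (λ t → t + ℕtoℚ n * a) (ℚP.*-identityˡ a)))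

e : ∀ {n} → Fin n → Vecℚ n
e j i = idMat i j

idMat-sym : ∀ {n} (i j : Fin n) → idMat i j ≡ idMat j i
idMat-sym zero    zero    = refl
idMat-sym zero    (suc j) = refl
idMat-sym (suc i) zero    = refl
idMat-sym (suc i) (suc j) = idMat-sym i j

idMat-diag : ∀ {n} (i : Fin n) → idMat i i ≡ 1ℚ
idMat-diag zero    = refl
idMat-diag (suc i) = idMat-diag i

idMat-inject≤ : ∀ {k n} (i j : Fin k) (k≤n : k ℕ.≤ n) →
                idMat (inject≤ i k≤n) (inject≤ j k≤n) ≡ idMat i j
idMat-inject≤ zero    zero    (ℕ.s≤s _)   = refl
idMat-inject≤ zero    (suc j) (ℕ.s≤s _)   = refl
idMat-inject≤ (suc i) zero    (ℕ.s≤s _)   = refl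
idMat-inject≤ (suc i) (suc j) (ℕ.s≤s k≤n) = idMat-inject≤ i j k≤n

sumF-*idMat : ∀ {n} (f : Fin n → ℚ) j → sumF (λ k → f k * idMat k j) ≡ f j
sumF-*idMat {suc n} f zero = begin
  f zero * 1ℚ + sumF (λ k → f (suc k) * 0ℚ)  ≡⟨ cong₂ _+_ (ℚP.*-identityʳ (f zero))
                                                  (trans (sumF-cong (ℚP.*-zeroʳ ∘ f ∘ suc)) (sumF-0 n)) ⟩
  f zero + 0ℚ                                ≡⟨ ℚP.+-identityʳ (f zero) ⟩
  f zero                                     ∎
  where open ≡-Reasoning
sumF-*idMat {suc n} f (suc j) =
  trans (cong₂ _+_ (ℚP.*-zeroʳ (f zero)) (sumF-*idMat (f ∘ suc) j)) (ℚP.+-identityˡ (f (suc j)))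

idMat-· : ∀ {n} (x : Vecℚ n) i → (idMat · x) i ≡ x i
idMat-· x i = trans (sumF-cong (λ k → trans (ℚP.*-comm (idMat i k) (x k)) (cong (x k *_) (idMat-sym i k))))
                    (sumF-*idMat x i)

·-e : ∀ {n} (A : Mat n) i j → (A · e j) i ≡ A i j
·-e A i j = sumF-*idMat (A i) j

normSq-e : ∀ {n} (j : Fin n) → normSq (e j) ≡ 1ℚ
normSq-e j = trans (sumF-*idMat (e j) j) (idMat-diag j)

normSq-nonNeg : ∀ {n} (v : Vecℚ n) → 0ℚ ≤ normSq v
normSq-nonNeg v = sumF-nonNeg (λ i → 0≤p*p (v i))

·-cong : ∀ {n} (A : Mat n) {v w : Vecℚ n} → (∀ i → v i ≡ w i) → ∀ i → (A · v) i ≡ (A · w) i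
·-cong A v≗w i = sumF-cong (λ j → cong (A i j *_) (v≗w j))

·-zeroʳ : ∀ {n} (A : Mat n) {v : Vecℚ n} → (∀ i → v i ≡ 0ℚ) → ∀ i → (A · v) i ≡ 0ℚ
·-zeroʳ {n} A v≡0 i = trans (·-cong A v≡0 i) (trans (sumF-cong (ℚP.*-zeroʳ ∘ A i)) (sumF-0 n))

·-assoc : ∀ {n} (S T : Mat n) (v : Vecℚ n) i → (S · (T · v)) i ≡ ((S ⊙ T) · v) i
·-assoc S T v i = begin
  sumF (λ k → S i k * sumF (λ j → T k j * v j))
    ≡⟨ sumF-cong (λ k → sumF-*ˡ (S i k) (λ j → T k j * v j)) ⟩
  sumF (λ k → sumF (λ j → S i k * (T k j * v j)))
    ≡⟨ sumF-cong (λ k → sumF-cong (λ j → sym (ℚP.*-assoc (S i k) (T k j) (v j)))) ⟩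
  sumF (λ k → sumF (λ j → S i k * T k j * v j))
    ≡⟨ sumF-comm (λ k j → S i k * T k j * v j) ⟩
  sumF (λ j → sumF (λ k → S i k * T k j * v j))
    ≡⟨ sumF-cong (λ j → sym (sumF-*ʳ (v j) (λ k → S i k * T k j))) ⟩
  sumF (λ j → (S ⊙ T) i j * v j)
    ∎
  where open ≡-Reasoning

inverse-cancel : ∀ {n} (S T : Mat n) → (∀ i j → (S ⊙ T) i j ≡ idMat i j) →
                 ∀ v i → (S · (T · v)) i ≡ v i
inverse-cancel S T ST≡I v i =
  trans (·-assoc S T v i) (trans (sumF-cong (λ j → cong (_* v j) (ST≡I i j))) (idMat-· v i))

·-nonzero : ∀ {n} (S T : Mat n) {v : Vecℚ n} → (∀ i j → (S ⊙ T) i j ≡ idMat i j) →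
            ¬ (∀ i → v i ≡ 0ℚ) → ¬ (∀ i → (T · v) i ≡ 0ℚ)
·-nonzero S T {v} ST≡I v≢0 Tv≡0 =
  v≢0 (λ i → trans (sym (inverse-cancel S T ST≡I v i)) (·-zeroʳ S Tv≡0 i))

e-nonzero : ∀ {n} (j : Fin n) → ¬ (∀ i → e j i ≡ 0ℚ)
e-nonzero j ej≡0 with trans (sym (idMat-diag j)) (ej≡0 j)
... | ()

IsInt : ℚ → Set
IsInt p = Σ ℤ λ k → p ≡ ℤtoℚ k

Integral : ∀ {n} → Vecℚ n → Set
Integral v = ∀ i → IsInt (v i)

¬IsInt-½ : ¬ IsInt ½
¬IsInt-½ (k , ½≡k) with trans (cong ↧ₙ_ ½≡k) (cong ↧ₙ_ (ℤtoℚ≡mkℚ k))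
... | ()

IsInt-* : ∀ {p q} → IsInt p → IsInt q → IsInt (p * q)
IsInt-* (a , p≡a) (b , q≡b) = a ℤ.* b , trans (cong₂ _*_ p≡a q≡b) (sym (ℤtoℚ-* a b))

IsInt-sumF : ∀ {n} {f : Fin n → ℚ} → (∀ i → IsInt (f i)) → IsInt (sumF f)
IsInt-sumF {zero}  _     = + 0 , refl
IsInt-sumF {suc n} f-int with f-int zero | IsInt-sumF (f-int ∘ suc)
... | a , f₀≡a | b , Σf≡b = a ℤ.+ b , trans (cong₂ _+_ f₀≡a Σf≡b) (sym (ℤtoℚ-+ a b))

idMat-isInt : ∀ {n} (i j : Fin n) → IsInt (idMat i j)
idMat-isInt zero    zero    = + 1 , refl
idMat-isInt zero    (suc j) = + 0 , refl
idMat-isInt (suc i) zero    = + 0 , refl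
idMat-isInt (suc i) (suc j) = idMat-isInt i j

integral-· : ∀ {n} {A : Mat n} {x : Vecℚ n} →
             (∀ j → Integral (A · e j)) → Integral x → Integral (A · x)
integral-· {A = A} columns-int x-int i =
  IsInt-sumF (λ j → IsInt-* (subst IsInt (·-e A i j) (columns-int j i)) (x-int j))

inLattice-cong : ∀ {n} (B : Mat n) {v w : Vecℚ n} → InLattice B v → (∀ i → v i ≡ w i) → InLattice B w
inLattice-cong B (z , v≡Bz) v≗w = z , λ i → trans (sym (v≗w i)) (v≡Bz i)

inℤⁿ⇒integral : ∀ {n} {v : Vecℚ n} → InLattice ℤⁿ v → Integral v
inℤⁿ⇒integral (z , v≡z) i = z i , trans (v≡z i) (idMat-· (ℤtoℚ ∘ z) i)

integral⇒inℤⁿ : ∀ {n} {v : Vecℚ n} → Integral v → InLattice ℤⁿ v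
integral⇒inℤⁿ v-int =
  proj₁ ∘ v-int , λ i → trans (proj₂ (v-int i)) (sym (idMat-· (ℤtoℚ ∘ proj₁ ∘ v-int) i))

integral-1≤normSq : ∀ {n} {v : Vecℚ n} → Integral v → ¬ (∀ i → v i ≡ 0ℚ) → 1ℚ ≤ normSq v
integral-1≤normSq {n} {v} v-int v≢0 with FinP.¬∀⟶∃¬ n (λ i → v i ≡ 0ℚ) (λ i → v i ℚP.≟ 0ℚ) v≢0
... | j , vⱼ≢0 = ℚP.≤-trans 1≤vⱼ² (≤-sumF (λ i → 0≤p*p (v i)) j)
  where
  k : ℤ
  k = proj₁ (v-int j)
  vⱼ≡k : v j ≡ ℤtoℚ k
  vⱼ≡k = proj₂ (v-int j)
  1≤vⱼ² : 1ℚ ≤ v j * v j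
  1≤vⱼ² = subst (1ℚ ≤_) (sym (cong₂ _*_ vⱼ≡k vⱼ≡k))
            (1≤ℤtoℚ² {k} (λ k≡0 → vⱼ≢0 (trans vⱼ≡k (cong ℤtoℚ k≡0))))

record SuccMinimaOne {n} (B : Mat n) : Set where
  field
    e∈ : ∀ j → InLattice B (e j)
    1≤normSq : ∀ {v} → InLattice B v → ¬ (∀ i → v i ≡ 0ℚ) → 1ℚ ≤ normSq v

ℤⁿ-succMinimaOne : ∀ {n} → SuccMinimaOne (ℤⁿ {n})
ℤⁿ-succMinimaOne = record
  { e∈       = λ j → integral⇒inℤⁿ (λ i → idMat-isInt i j)
  ; 1≤normSq = integral-1≤normSq ∘ inℤⁿ⇒integral
  }

ℤⁿ-nonsingular : ∀ {n} → Nonsingular (ℤⁿ {n})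
ℤⁿ-nonsingular x Ix≡0 j = trans (sym (idMat-· x j)) (Ix≡0 j)

isSuccMinSq-1 : ∀ {n} {B : Mat n} → SuccMinimaOne B → (i : Fin n) → IsSuccMinSq B (suc (toℕ i)) 1ℚ
isSuccMinSq-1 {n} {B} B-min i =
  (first-e , SuccMinimaOne.e∈ B-min ∘ ι , first-e-indep , ℚP.≤-reflexive ∘ normSq-e ∘ ι) , minimal
  where
  i<n : toℕ i ℕ.< n
  i<n = FinP.toℕ<n i
  ι : Fin (suc (toℕ i)) → Fin n
  ι j = inject≤ j i<n
  first-e : Fin (suc (toℕ i)) → Vecℚ n
  first-e = e ∘ ι
  first-e-indep : LinIndep first-e
  first-e-indep c Σce≡0 j = begin
    c j                                         ≡⟨ sym (sumF-*idMat c j) ⟩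
    sumF (λ j′ → c j′ * idMat j′ j)              ≡⟨ sumF-cong (λ j′ → cong (c j′ *_)
                                                      (trans (idMat-sym j′ j) (sym (idMat-inject≤ j j′ i<n)))) ⟩
    sumF (λ j′ → c j′ * first-e j′ (ι j))       ≡⟨ Σce≡0 (ι j) ⟩
    0ℚ                                          ∎
    where open ≡-Reasoning
  minimal : ∀ r → HasIndep B (suc (toℕ i)) r → 1ℚ ≤ r
  minimal r (ws , ws∈ , ws-indep , ws≤r) =
    ℚP.≤-trans (SuccMinimaOne.1≤normSq B-min (ws∈ zero) ws₀≢0) (ws≤r zero)
    where
    ws₀≢0 : ¬ (∀ k → ws zero k ≡ 0ℚ)
    ws₀≢0 ws₀≡0
      with ws-indep (idMat zero) (λ k → trans (idMat-· (λ j → ws j k) zero) (ws₀≡0 k)) zero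
    ... | ()

isMSq-1 : ∀ {m} {B₁ B₂ : Mat (suc m)} → SuccMinimaOne B₁ → SuccMinimaOne B₂ → IsMSq B₁ B₂ 1ℚ
isMSq-1 B₁-min B₂-min = (λ _ → 1ℚ) , (λ _ → 1ℚ) , isSuccMinSq-1 B₁-min , isSuccMinSq-1 B₂-min ,
                        (λ _ → ℚP.≤-refl) , (zero , refl)

preimage∈ : ∀ {n} {T Tinv B₁ B₂ : Mat n} {w : Vecℚ n} → MapsOnto T Tinv B₁ B₂ →
            InLattice B₂ w → InLattice B₁ (Tinv · w)
preimage∈ {T = T} {Tinv} {B₁} {w = w} (_ , TinvT≡I , _ , onto) w∈ with onto w w∈
... | v , v∈ , Tv≡w =
  inLattice-cong B₁ v∈ (λ i → trans (sym (inverse-cancel Tinv T TinvT≡I v i)) (·-cong Tinv Tv≡w i))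

inverse-integral⇒⊆ℤⁿ : ∀ {n} {T Tinv B : Mat n} {v : Vecℚ n} → MapsOnto T Tinv B ℤⁿ →
                        (∀ j → Integral (Tinv · e j)) → InLattice B v → Integral v
inverse-integral⇒⊆ℤⁿ {T = T} {Tinv} {v = v} (_ , TinvT≡I , into , _) Tinv-int v∈ i =
  subst IsInt (inverse-cancel Tinv T TinvT≡I v i)
    (integral-· {A = Tinv} Tinv-int (inℤⁿ⇒integral (into v v∈)) i)

CondSqGe-mono : ∀ {n} {T Tinv : Mat n} {X Y : ℚ} → X ≤ Y → CondSqGe T Tinv Y → CondSqGe T Tinv X
CondSqGe-mono X≤Y cond q q<X = cond q (ℚP.<-≤-trans q<X X≤Y)

-- ‖T‖ ≥ |T eⱼ| ≥ 1 and ‖T⁻¹‖ ≥ |T⁻¹ eⱼ|, both witnessed by the unit vector eⱼ.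
CondSqGe-inverseColumn : ∀ {n} {T Tinv B : Mat n} → SuccMinimaOne B → MapsOnto T Tinv B ℤⁿ →
                         ∀ j → CondSqGe T Tinv (normSq (Tinv · e j))
CondSqGe-inverseColumn {T = T} {Tinv} B-min (_ , TinvT≡I , into , _) j q q<X = e j , e j , (begin-strict
  q * normSq (e j) * normSq (e j)  ≡⟨ cong₂ (λ a b → q * a * b) (normSq-e j) (normSq-e j) ⟩
  q * 1ℚ * 1ℚ                      ≡⟨ trans (ℚP.*-identityʳ (q * 1ℚ)) (ℚP.*-identityʳ q) ⟩
  q                                <⟨ q<X ⟩
  X                                ≡⟨ sym (ℚP.*-identityˡ X) ⟩
  1ℚ * X                           ≤⟨ ℚP.*-monoʳ-≤-nonNeg X {{ℚ.nonNegative (normSq-nonNeg (Tinv · e j))}}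
                                                              1≤|Teⱼ|² ⟩
  normSq (T · e j) * X             ∎)
  where
  open ℚP.≤-Reasoning
  X : ℚ
  X = normSq (Tinv · e j)
  1≤|Teⱼ|² : 1ℚ ≤ normSq (T · e j)
  1≤|Teⱼ|² = SuccMinimaOne.1≤normSq ℤⁿ-succMinimaOne
    (into (e j) (SuccMinimaOne.e∈ B-min j)) (·-nonzero Tinv T TinvT≡I (e-nonzero j))

LongInverseColumn : ∀ {n} → ℚ → Mat n → Set
LongInverseColumn {n} X B =
  ∀ T Tinv → MapsOnto T Tinv B ℤⁿ → ∃ λ (j : Fin n) → X ≤ normSq (Tinv · e j)

succMinimaOne⇒longInverseColumn : ∀ {m} {B : Mat (suc m)} → SuccMinimaOne B → LongInverseColumn 1ℚ B
succMinimaOne⇒longInverseColumn {B = B} B-min T Tinv T⇄@(TTinv≡I , _) =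
  zero , SuccMinimaOne.1≤normSq B-min
           (preimage∈ {T = T} {Tinv} {B} {ℤⁿ} T⇄ (SuccMinimaOne.e∈ ℤⁿ-succMinimaOne zero))
           (·-nonzero T Tinv TTinv≡I (e-nonzero zero))

FarFromℤⁿ : ℚ → ℕ → Set
FarFromℤⁿ c n =
  Σ (Mat n) λ B → Nonsingular B ×
    Σ ℚ λ m₁ → Σ ℚ λ m₂ → IsMSq B ℤⁿ m₁ × IsMSq ℤⁿ B m₂ ×
      ((T Tinv : Mat n) → MapsOnto T Tinv B ℤⁿ → CondSqGe T Tinv (c * ℕtoℚ n * m₁ * m₂))

farFromℤⁿ : ∀ {m c X} (B : Mat (suc m)) → Nonsingular B → SuccMinimaOne B →
            LongInverseColumn X B → c * ℕtoℚ (suc m) ≤ X → FarFromℤⁿ c (suc m)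
farFromℤⁿ {m} {c} {X} B B-nonsingular B-min B-long cn≤X =
  B , B-nonsingular , 1ℚ , 1ℚ , isMSq-1 B-min ℤⁿ-succMinimaOne , isMSq-1 ℤⁿ-succMinimaOne B-min , distorted
  where
  cn11≡cn : c * ℕtoℚ (suc m) * 1ℚ * 1ℚ ≡ c * ℕtoℚ (suc m)
  cn11≡cn = trans (ℚP.*-identityʳ (c * ℕtoℚ (suc m) * 1ℚ)) (ℚP.*-identityʳ (c * ℕtoℚ (suc m)))
  distorted : (T Tinv : Mat (suc m)) → MapsOnto T Tinv B ℤⁿ →
              CondSqGe T Tinv (c * ℕtoℚ (suc m) * 1ℚ * 1ℚ)
  distorted T Tinv T⇄ with B-long T Tinv T⇄
  ... | j , X≤|T⁻¹eⱼ|² = CondSqGe-mono {T = T} {Tinv}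
    (ℚP.≤-trans (ℚP.≤-reflexive cn11≡cn) (ℚP.≤-trans cn≤X X≤|T⁻¹eⱼ|²))
    (CondSqGe-inverseColumn {T = T} {Tinv} B-min T⇄ j)

-- The lattice Dₙ* = ℤⁿ ∪ (ℤⁿ + ½𝟙)

D⋆ : ∀ {m} → Mat (suc m)
D⋆ i zero    = ½
D⋆ i (suc j) = idMat i (suc j)

D⋆·-zero : ∀ {m} (x : Vecℚ (suc m)) → (D⋆ · x) zero ≡ ½ * x zero
D⋆·-zero {m} x = begin
  ½ * x zero + sumF (λ j → 0ℚ * x (suc j))  ≡⟨ cong (λ t → ½ * x zero + t)
                                                 (trans (sumF-cong (ℚP.*-zeroˡ ∘ x ∘ suc)) (sumF-0 m)) ⟩
  ½ * x zero + 0ℚ                           ≡⟨ ℚP.+-identityʳ (½ * x zero) ⟩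
  ½ * x zero                                ∎
  where open ≡-Reasoning

D⋆·-suc : ∀ {m} (x : Vecℚ (suc m)) i → (D⋆ · x) (suc i) ≡ ½ * x zero + x (suc i)
D⋆·-suc x i = cong (λ t → ½ * x zero + t) (idMat-· (x ∘ suc) i)

D⋆-nonsingular : ∀ {m} → Nonsingular (D⋆ {m})
D⋆-nonsingular x D⋆x≡0 = FinP.∀-cons x₀≡0 xₛ≡0
  where
  open ≡-Reasoning
  x₀≡0 : x zero ≡ 0ℚ
  x₀≡0 = begin
    x zero                       ≡⟨ sym (ℚP.*-identityˡ (x zero)) ⟩
    (ℤtoℚ (+ 2) * ½) * x zero    ≡⟨ ℚP.*-assoc (ℤtoℚ (+ 2)) ½ (x zero) ⟩
    ℤtoℚ (+ 2) * (½ * x zero)    ≡⟨ cong (ℤtoℚ (+ 2) *_) (trans (sym (D⋆·-zero x)) (D⋆x≡0 zero)) ⟩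
    0ℚ                           ∎
  xₛ≡0 : ∀ i → x (suc i) ≡ 0ℚ
  xₛ≡0 i = begin
    x (suc i)                    ≡⟨ sym (ℚP.+-identityˡ (x (suc i))) ⟩
    ½ * 0ℚ + x (suc i)           ≡⟨ cong (λ t → ½ * t + x (suc i)) (sym x₀≡0) ⟩
    ½ * x zero + x (suc i)       ≡⟨ trans (sym (D⋆·-suc x i)) (D⋆x≡0 (suc i)) ⟩
    0ℚ                           ∎

e∈D⋆ : ∀ {m} (j : Fin (suc m)) → InLattice D⋆ (e j)
e∈D⋆ zero = z , λ { zero → sym (D⋆·-zero (ℤtoℚ ∘ z)) ; (suc k) → sym (D⋆·-suc (ℤtoℚ ∘ z) k) }
  where
  z : Fin _ → ℤ
  z zero    = + 2
  z (suc _) = -[1+ 0 ]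
e∈D⋆ (suc j) = z , λ
  { zero    → sym (D⋆·-zero (ℤtoℚ ∘ z))
  ; (suc k) → trans (proj₂ (idMat-isInt k j))
                    (sym (trans (D⋆·-suc (ℤtoℚ ∘ z) k) (ℚP.+-identityˡ (ℤtoℚ (z (suc k))))))
  }
  where
  z : Fin _ → ℤ
  z zero    = + 0
  z (suc k) = proj₁ (idMat-isInt k j)

½𝟙∈D⋆ : ∀ {m} → InLattice (D⋆ {m}) (λ _ → ½)
½𝟙∈D⋆ = z , λ { zero → sym (D⋆·-zero (ℤtoℚ ∘ z)) ; (suc k) → sym (D⋆·-suc (ℤtoℚ ∘ z) k) }
  where
  z : Fin _ → ℤ
  z zero    = + 1
  z (suc _) = + 0

HalfIntegral : ∀ {n} → Vecℚ n → Set
HalfIntegral v = ∀ i → Σ ℤ λ k → v i ≡ ½ + ℤtoℚ k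

halfIntegral-normSq : ∀ {n} {v : Vecℚ n} → HalfIntegral v → ℕtoℚ n * ¼ ≤ normSq v
halfIntegral-normSq v-half = ℕtoℚ*≤sumF λ i →
  let k , vᵢ≡½+k = v-half i in subst (λ t → ¼ ≤ t * t) (sym vᵢ≡½+k) (¼≤[½+ℤtoℚ]² k)

D⋆-coordinates : ∀ {m} (z : Fin (suc m) → ℤ) {b q} → z zero ≡ + b ℤ.+ q ℤ.* + 2 →
                 ∀ i → Σ ℤ λ k → (D⋆ · (ℤtoℚ ∘ z)) i ≡ ½ * ℤtoℚ (+ b) + ℤtoℚ k
D⋆-coordinates z {b} {q} z₀≡b+2q zero = q , (begin
  (D⋆ · (ℤtoℚ ∘ z)) zero          ≡⟨ D⋆·-zero (ℤtoℚ ∘ z) ⟩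
  ½ * ℤtoℚ (z zero)               ≡⟨ cong (λ t → ½ * ℤtoℚ t) z₀≡b+2q ⟩
  ½ * ℤtoℚ (+ b ℤ.+ q ℤ.* + 2)    ≡⟨ ½*ℤtoℚ-+-*2 (+ b) q ⟩
  ½ * ℤtoℚ (+ b) + ℤtoℚ q         ∎)
  where open ≡-Reasoning
D⋆-coordinates z {b} {q} z₀≡b+2q (suc i) = q ℤ.+ z (suc i) , (begin
  (D⋆ · (ℤtoℚ ∘ z)) (suc i)            ≡⟨ D⋆·-suc (ℤtoℚ ∘ z) i ⟩
  ½ * ℤtoℚ (z zero) + zᵢ               ≡⟨ cong (λ t → ½ * ℤtoℚ t + zᵢ) z₀≡b+2q ⟩
  ½ * ℤtoℚ (+ b ℤ.+ q ℤ.* + 2) + zᵢ    ≡⟨ cong (λ t → t + zᵢ) (½*ℤtoℚ-+-*2 (+ b) q) ⟩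
  ½ * ℤtoℚ (+ b) + ℤtoℚ q + zᵢ         ≡⟨ ℚP.+-assoc (½ * ℤtoℚ (+ b)) (ℤtoℚ q) zᵢ ⟩
  ½ * ℤtoℚ (+ b) + (ℤtoℚ q + zᵢ)       ≡⟨ cong (λ t → ½ * ℤtoℚ (+ b) + t) (sym (ℤtoℚ-+ q (z (suc i)))) ⟩
  ½ * ℤtoℚ (+ b) + ℤtoℚ (q ℤ.+ z (suc i)) ∎)
  where
  open ≡-Reasoning
  zᵢ : ℚ
  zᵢ = ℤtoℚ (z (suc i))

D⋆-classify : ∀ {m} {v : Vecℚ (suc m)} → InLattice D⋆ v → Integral v ⊎ HalfIntegral v
D⋆-classify {v = v} (z , v≡D⋆z) with z zero %ℕ 2 | n%ℕd<d (z zero) 2 | a≡a%ℕn+[a/ℕn]*n (z zero) 2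
... | 0 | _ | z₀≡2q = inj₁ λ i →
  let k , D⋆zᵢ≡k = D⋆-coordinates z {0} {z zero /ℕ 2} z₀≡2q i
  in  k , trans (v≡D⋆z i) (trans D⋆zᵢ≡k (ℚP.+-identityˡ (ℤtoℚ k)))
... | 1 | _ | z₀≡1+2q = inj₂ λ i →
  let k , D⋆zᵢ≡½+k = D⋆-coordinates z {1} {z zero /ℕ 2} z₀≡1+2q i
  in  k , trans (v≡D⋆z i) D⋆zᵢ≡½+k
... | suc (suc _) | ℕ.s≤s (ℕ.s≤s ()) | _

D⋆-succMinimaOne : ∀ {m} → 4 ℕ.≤ suc m → SuccMinimaOne (D⋆ {m})
D⋆-succMinimaOne {m} 4≤n = record { e∈ = e∈D⋆ ; 1≤normSq = 1≤normSq }
  where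
  1≤n¼ : 1ℚ ≤ ℕtoℚ (suc m) * ¼
  1≤n¼ = ℚP.*-monoʳ-≤-nonNeg ¼ (ℕtoℚ-mono-≤ 4≤n)
  1≤normSq : ∀ {v} → InLattice D⋆ v → ¬ (∀ i → v i ≡ 0ℚ) → 1ℚ ≤ normSq v
  1≤normSq v∈ v≢0 with D⋆-classify v∈
  ... | inj₁ v-int  = integral-1≤normSq v-int v≢0
  ... | inj₂ v-half = ℚP.≤-trans 1≤n¼ (halfIntegral-normSq v-half)

∃⊎∀ : ∀ {n} {P Q : Fin n → Set} → (∀ j → P j ⊎ Q j) → ∃ Q ⊎ (∀ j → P j)
∃⊎∀ {zero}  _   = inj₂ λ ()
∃⊎∀ {suc n} P⊎Q with P⊎Q zero | ∃⊎∀ (P⊎Q ∘ suc)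
... | inj₂ q₀ | _            = inj₁ (zero , q₀)
... | inj₁ _  | inj₁ (j , q) = inj₁ (suc j , q)
... | inj₁ p₀ | inj₂ p       = inj₂ (FinP.∀-cons p₀ p)

D⋆-inverse-not-integral : ∀ {m} {T Tinv : Mat (suc m)} → MapsOnto T Tinv D⋆ ℤⁿ →
                          ¬ (∀ j → Integral (Tinv · e j))
D⋆-inverse-not-integral {T = T} {Tinv} T⇄ columns-int =
  ¬IsInt-½ (inverse-integral⇒⊆ℤⁿ {T = T} {Tinv} {D⋆} {λ _ → ½} T⇄ columns-int ½𝟙∈D⋆ zero)

D⋆-longInverseColumn : ∀ {m} → LongInverseColumn (ℕtoℚ (suc m) * ¼) (D⋆ {m})
D⋆-longInverseColumn {m} T Tinv T⇄ =
  [ long , (λ columns-int → contradiction columns-int (D⋆-inverse-not-integral {T = T} {Tinv} T⇄)) ]′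
    (∃⊎∀ column-classes)
  where
  column-classes : ∀ j → Integral (Tinv · e j) ⊎ HalfIntegral (Tinv · e j)
  column-classes j =
    D⋆-classify (preimage∈ {T = T} {Tinv} {D⋆} {ℤⁿ} T⇄ (SuccMinimaOne.e∈ ℤⁿ-succMinimaOne j))
  long : ∃ (λ j → HalfIntegral (Tinv · e j)) → ∃ λ j → ℕtoℚ (suc m) * ¼ ≤ normSq (Tinv · e j)
  long (j , column-half) = j , halfIntegral-normSq column-half

farFromℤⁿ-¼ : ∀ n → 1 ℕ.≤ n → FarFromℤⁿ ¼ n
farFromℤⁿ-¼ (suc m) _ with 4 ℕ.≤? suc m
... | yes 4≤n = farFromℤⁿ {c = ¼} {X = ℕtoℚ (suc m) * ¼}
                  D⋆ D⋆-nonsingular (D⋆-succMinimaOne 4≤n) D⋆-longInverseColumn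
                  (ℚP.≤-reflexive (ℚP.*-comm ¼ (ℕtoℚ (suc m))))
... | no  4≰n = farFromℤⁿ {c = ¼} {X = 1ℚ}
                  ℤⁿ ℤⁿ-nonsingular ℤⁿ-succMinimaOne (succMinimaOne⇒longInverseColumn ℤⁿ-succMinimaOne)
                  (ℚP.*-monoˡ-≤-nonNeg ¼ (ℕtoℚ-mono-≤ (ℕP.<⇒≤ (ℕP.≰⇒> 4≰n))))

proposition5p2 :
    Σ ℚ λ c → 0ℚ < c ×
      ((n : ℕ) → 1 Data.Nat.≤ n →
        Σ (Mat n) λ B → Nonsingular B ×
          Σ ℚ λ m₁ → Σ ℚ λ m₂ → IsMSq B ℤⁿ m₁ × IsMSq ℤⁿ B m₂ ×
            ((T Tinv : Mat n) → MapsOnto T Tinv B ℤⁿ →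
              CondSqGe T Tinv (c * ℕtoℚ n * m₁ * m₂)))
proposition5p2 = ¼ , ℚP.positive⁻¹ ¼ , farFromℤⁿ-¼
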